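{- Let $c\ge 3$, $b\ge 2$ be integers. Then $c$ is an eigenvalue of the clique $2$-down Laplacian $\delta_1\delta_1^T$ of $G_{c,b}$ with multiplicity at least $(b-1)(c-1)$, and $(b-1)(c-1)$ linearly independent eigenvectors for the eigenvalue $c$ are $$v_{x,y}=\sum_{1\le i\le c,\ i\ne x}\Big([\{i,x,y\}:\{x,y\}]\, e_{\{i,x,y\}}-[\{i,x,b+c\}:\{x,b+c\}]\, e_{\{i,x,b+c\}}\Big)$$ for $2\le x\le c$ and $c+1\le y\le b+c-1$.
   Context: $G_{c,b}$ is the graph on vertex set $\{1,\dots,b+c\}$ (natural order) with edges $\{i,j\}$ for $1\le i<j\le c$ and $\{i,j\}$ for $c+1\le i\le c+b$, $1\le j\le c$. $\mathcal T_{c,b}$ is the set of all triangles of $G_{c,b}$, and $e_T$ denotes the standard basis vector of $\mathbb R^{\mathcal T_{c,b}}$ indexed by $T$. For $T=\{p,q,r\}$ with $p<q<r$ and an edge $e$, $[T:e]$ is $1$ if $e=\{p,q\}$ or $\{q,r\}$, $-1$ if $e=\{p,r\}$, $0$ if $e\not\subset T$; $\delta_1$ is the $\mathcal T_{c,b}\times E(G_{c,b})$ matrix with entries $[T:e]$.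
   Formalization: Linear independence of the eigenvectors $v_{x,y}$ is asserted only for rational coefficients, not for real ones. -}

module Defs where

open import Data.Nat using (ℕ; zero; suc; _+_; _∸_; _≡ᵇ_; _≤ᵇ_)
open import Data.Bool using (Bool; true; false; if_then_else_; _∧_; not)
open import Data.Product using (_×_; _,_)
open import Data.List using (List; []; _∷_; map; concatMap; upTo; filterᵇ; foldr)
open import Data.Integer using (+_)
open import Data.Rational using (ℚ; 0ℚ; 1ℚ; _/_) renaming (_+_ to _+ℚ_; _*_ to _*ℚ_; _-_ to _-ℚ_; -_ to -ℚ_)

-- Vertices are natural numbers; an edge {i,j} with i<j is the pair (i , j);
-- a triangle {p,q,r} with p<q<r is the triple (p , q , r).
Edge : Set
Edge = ℕ × ℕ

Tri : Set
Tri = ℕ × ℕ × ℕ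

interval : ℕ → ℕ → List ℕ
interval lo hi = map (λ k → lo + k) (upTo (suc hi ∸ lo))

edges : ℕ → ℕ → List Edge
edges c b =
  concatMap (λ i → map (λ j → (i , j)) (interval (suc i) c)) (interval 1 c)
  Data.List.++ concatMap (λ j → map (λ i → (j , i)) (interval (suc c) (b + c))) (interval 1 c)

-- Triangles of G_{c,b}, as sorted triples p<q<r: all three pairs are edges,
-- i.e. p < q ≤ c and q < r ≤ b + c.
triangles : ℕ → ℕ → List Tri
triangles c b =
  concatMap (λ p → concatMap (λ q → map (λ r → (p , q , r)) (interval (suc q) (b + c)))
                               (interval (suc p) c))
            (interval 1 c)

sort2 : ℕ → ℕ → Edge
sort2 i j = if i ≤ᵇ j then (i , j) else (j , i)

sort3 : ℕ → ℕ → ℕ → Tri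
sort3 i j k with sort2 i j
... | (a , a') = if k ≤ᵇ a then (k , a , a')
                 else if k ≤ᵇ a' then (a , k , a')
                 else (a , a' , k)

eqE : Edge → Edge → Bool
eqE (i , j) (i' , j') = (i ≡ᵇ i') ∧ (j ≡ᵇ j')

eqT : Tri → Tri → Bool
eqT (p , q , r) (p' , q' , r') = (p ≡ᵇ p') ∧ ((q ≡ᵇ q') ∧ (r ≡ᵇ r'))

incidence : Tri → Edge → ℚ
incidence (p , q , r) e =
  if eqE e (p , q) then 1ℚ
  else if eqE e (q , r) then 1ℚ
  else if eqE e (p , r) then -ℚ 1ℚ
  else 0ℚ

sumℚ : List ℚ → ℚ
sumℚ = foldr _+ℚ_ 0ℚ

-- vectors in ℝ^{T_{c,b}} (with rational entries), as functions on triples;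
-- only their values on  triangles c b  are relevant.
TVec : Set
TVec = Tri → ℚ

basis : Tri → TVec
basis T T' = if eqT T T' then 1ℚ else 0ℚ

downLaplacian : ℕ → ℕ → TVec → TVec
downLaplacian c b v T =
  sumℚ (map (λ e → incidence T e *ℚ sumℚ (map (λ T' → incidence T' e *ℚ v T') (triangles c b)))
            (edges c b))

vxy : ℕ → ℕ → ℕ → ℕ → TVec
vxy c b x y T =
  sumℚ (map (λ i → incidence (sort3 i x y) (sort2 x y) *ℚ basis (sort3 i x y) T
                 -ℚ incidence (sort3 i x (b + c)) (sort2 x (b + c)) *ℚ basis (sort3 i x (b + c)) T)
            (filterᵇ (λ i → not (i ≡ᵇ x)) (interval 1 c)))

ℕtoℚ : ℕ → ℚ
ℕtoℚ n = + n / 1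

-- On a triangle p < q < r of G_{c,b} the vector v_{x,y} takes the value ε(r)([q = x] − [p = x]),
-- where ε(r) = [r = y] − [r = b + c].  Each summand of v_{x,y} is the difference of the oriented
-- triangles (i, x, y) and (i, x, b + c), so δ₁ᵀ maps it to ε(k)([j = x] − [j = i]) on an edge
-- j < k; summing over i ≠ x gives (δ₁ᵀ v_{x,y})(j, k) = ε(k)(c[j = x] − 1).  Applying δ₁ at
-- (p, q, r) adds the values on (p, q) and (q, r) and subtracts the one on (p, r): the first
-- vanishes because q ≤ c, the other two combine to c · v_{x,y}(p, q, r).  For independence,
-- at the triangle (1, x, y) every v_{x',y'} vanishes except v_{x,y}, which is 1 there.

module Submission where

open import Defs
open import Data.Nat using (ℕ; zero; suc; _≤_; _<_; _+_; _∸_; _≡ᵇ_; _≤ᵇ_; s≤s; s≤s⁻¹)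
open import Data.Nat.Properties as ℕ
  using (+-cancelˡ-≡; m+[n∸m]≡n; ∸-monoˡ-<; m≤o∸n⇒m+n≤o; m∸n≢0⇒n<m; m<n⇒n≢0; +-comm;
         m≤m+n; <⇒≤; <⇒≢; >⇒≢; <-≤-trans; ≤-<-trans; ≤-trans; ≤-refl; <-trans; ≰⇒>; <⇒≱; <-cmp)
open import Data.Bool using (Bool; true; false; not; if_then_else_; _∧_)
open import Data.Product using (_×_; _,_; proj₂)
open import Data.Sum using (_⊎_; inj₁; inj₂)
open import Data.List using (List; []; _∷_; _++_; map; concatMap; filterᵇ; length; upTo)
open import Data.List.Properties using (length-map; length-upTo; map-∘)
open import Data.List.Relation.Unary.All as All using (All)
open import Data.List.Relation.Unary.Any using (here; there)
open import Data.List.Relation.Unary.Unique.Propositional using (Unique; _∷_)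
import Data.List.Relation.Unary.Unique.Propositional.Properties as Unique
open import Data.List.Membership.Propositional using (_∈_; find; lose)
open import Data.List.Membership.Propositional.Properties
  using (∈-map⁺; ∈-map⁻; ∈-upTo⁺; ∈-upTo⁻; ∈-concatMap⁺; ∈-concatMap⁻)
import Data.Integer.Properties as ℤ
open import Data.Integer using (+_; 1ℤ) renaming (_+_ to _+ℤ_; _*_ to _*ℤ_)
open import Data.Rational.Unnormalised using (mkℚᵘ; 1ℚᵘ; *≡*) renaming (_+_ to _+ᵘ_)
open import Data.Rational.Unnormalised.Properties
  using () renaming (+-congʳ to +ᵘ-congʳ; module ≃-Reasoning to ≃ᵘ-Reasoning)
open import Data.Rational using (ℚ; 0ℚ; 1ℚ; _*_; toℚᵘ)
  renaming (_+_ to _+ℚ_; _-_ to _-ℚ_; -_ to -ℚ_)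
open import Data.Rational.Properties
  using (+-*-commutativeRing; _≟_; toℚᵘ-injective; toℚᵘ-fromℚᵘ; toℚᵘ-homo-+;
         *-zeroˡ; *-zeroʳ; *-identityˡ; +-identityˡ; +-identityʳ; +-assoc; *-assoc; *-comm; *-distribˡ-+)
open import Relation.Nullary using (Dec; yes; no; contradiction)
open import Relation.Binary.Definitions using (tri<; tri≈; tri>)
open import Relation.Nullary.Decidable using (dec⇒maybe; dec-true; dec-false)
open import Relation.Binary.PropositionalEquality
open import Level using (0ℓ)
open import Tactic.RingSolver using (solve-∀)
open import Tactic.RingSolver.Core.AlmostCommutativeRing using (AlmostCommutativeRing; fromCommutativeRing)

ℚ-ring : AlmostCommutativeRing 0ℓ 0ℓ
ℚ-ring = fromCommutativeRing +-*-commutativeRing (λ q → dec⇒maybe (0ℚ ≟ q))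


-- Finite sums over lists

private variable
  A B : Set

Σ : List A → (A → ℚ) → ℚ
Σ xs f = sumℚ (map f xs)

infix 5 Σ
syntax Σ xs (λ x → e) = Σ[ x ∈ xs ] e

Σ-cong : (xs : List A) {f g : A → ℚ} → (∀ x → x ∈ xs → f x ≡ g x) → Σ xs f ≡ Σ xs g
Σ-cong []       f≗g = refl
Σ-cong (x ∷ xs) f≗g = cong₂ _+ℚ_ (f≗g x (here refl)) (Σ-cong xs (λ y y∈xs → f≗g y (there y∈xs)))

Σ-zero : (xs : List A) {f : A → ℚ} → (∀ x → x ∈ xs → f x ≡ 0ℚ) → Σ xs f ≡ 0ℚ
Σ-zero []       f≗0 = refl
Σ-zero (x ∷ xs) f≗0 = cong₂ _+ℚ_ (f≗0 x (here refl)) (Σ-zero xs (λ y y∈xs → f≗0 y (there y∈xs)))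

Σ-+ : (xs : List A) (f g : A → ℚ) → Σ[ x ∈ xs ] (f x +ℚ g x) ≡ Σ xs f +ℚ Σ xs g
Σ-+ []       f g = refl
Σ-+ (x ∷ xs) f g = trans (cong (f x +ℚ g x +ℚ_) (Σ-+ xs f g)) (interchange (f x) (g x) (Σ xs f) (Σ xs g))
  where
  interchange : ∀ a b s t → a +ℚ b +ℚ (s +ℚ t) ≡ a +ℚ s +ℚ (b +ℚ t)
  interchange = solve-∀ ℚ-ring

Σ-− : (xs : List A) (f g : A → ℚ) → Σ[ x ∈ xs ] (f x -ℚ g x) ≡ Σ xs f -ℚ Σ xs g
Σ-− []       f g = refl
Σ-− (x ∷ xs) f g = trans (cong (f x -ℚ g x +ℚ_) (Σ-− xs f g)) (interchange (f x) (g x) (Σ xs f) (Σ xs g))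
  where
  interchange : ∀ a b s t → a -ℚ b +ℚ (s -ℚ t) ≡ a +ℚ s -ℚ (b +ℚ t)
  interchange = solve-∀ ℚ-ring

Σ-*ˡ : (xs : List A) (k : ℚ) (f : A → ℚ) → Σ[ x ∈ xs ] (k * f x) ≡ k * Σ xs f
Σ-*ˡ []       k f = sym (*-zeroʳ k)
Σ-*ˡ (x ∷ xs) k f = trans (cong (k * f x +ℚ_) (Σ-*ˡ xs k f)) (sym (*-distribˡ-+ k (f x) (Σ xs f)))

Σ-swap : (xs : List A) (ys : List B) (f : A → B → ℚ) →
         Σ[ x ∈ xs ] Σ[ y ∈ ys ] f x y ≡ Σ[ y ∈ ys ] Σ[ x ∈ xs ] f x y
Σ-swap []       ys f = sym (Σ-zero ys (λ _ _ → refl))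
Σ-swap (x ∷ xs) ys f = trans (cong (Σ ys (f x) +ℚ_) (Σ-swap xs ys f))
                             (sym (Σ-+ ys (f x) (λ y → Σ[ x ∈ xs ] f x y)))

Σ-++ : (xs ys : List A) (f : A → ℚ) → Σ (xs ++ ys) f ≡ Σ xs f +ℚ Σ ys f
Σ-++ []       ys f = sym (+-identityˡ (Σ ys f))
Σ-++ (x ∷ xs) ys f = trans (cong (f x +ℚ_) (Σ-++ xs ys f)) (sym (+-assoc (f x) (Σ xs f) (Σ ys f)))

Σ-map : (g : B → A) (xs : List B) (f : A → ℚ) → Σ (map g xs) f ≡ Σ[ x ∈ xs ] f (g x)
Σ-map g xs f = cong sumℚ (sym (map-∘ xs))

Σ-concatMap : (g : B → List A) (xs : List B) (f : A → ℚ) →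
              Σ (concatMap g xs) f ≡ Σ[ x ∈ xs ] Σ (g x) f
Σ-concatMap g []       f = refl
Σ-concatMap g (x ∷ xs) f = trans (Σ-++ (g x) (concatMap g xs) f) (cong (Σ (g x) f +ℚ_) (Σ-concatMap g xs f))

Σ-support : {xs : List A} {a : A} (f : A → ℚ) → Unique xs → a ∈ xs →
            (∀ x → x ≢ a → f x ≡ 0ℚ) → Σ xs f ≡ f a
Σ-support {xs = x ∷ xs} f (x∉xs ∷ _) (here refl) f≗0 =
  trans (cong (f x +ℚ_) (Σ-zero xs (λ y y∈xs → f≗0 y (≢-sym (All.lookup x∉xs y∈xs)))))
        (+-identityʳ _)
Σ-support {xs = x ∷ xs} f (x∉xs ∷ xs-unique) (there a∈xs) f≗0 =
  trans (cong (_+ℚ Σ xs f) (f≗0 x (All.lookup x∉xs a∈xs)))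
        (trans (+-identityˡ _) (Σ-support f xs-unique a∈xs f≗0))

ℕtoℚ-suc : ∀ n → ℕtoℚ (suc n) ≡ 1ℚ +ℚ ℕtoℚ n
ℕtoℚ-suc n = toℚᵘ-injective (begin
  toℚᵘ (ℕtoℚ (suc n))            ≈⟨ toℚᵘ-fromℚᵘ (mkℚᵘ (+ suc n) 0) ⟩
  mkℚᵘ (+ suc n) 0               ≈⟨ *≡* (cross-multiplied (+ n)) ⟩
  1ℚᵘ +ᵘ mkℚᵘ (+ n) 0            ≈⟨ +ᵘ-congʳ 1ℚᵘ (toℚᵘ-fromℚᵘ (mkℚᵘ (+ n) 0)) ⟨
  toℚᵘ 1ℚ +ᵘ toℚᵘ (ℕtoℚ n)      ≈⟨ toℚᵘ-homo-+ 1ℚ (ℕtoℚ n) ⟨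
  toℚᵘ (1ℚ +ℚ ℕtoℚ n)           ∎)
  where
  open ≃ᵘ-Reasoning
  cross-multiplied : ∀ m → (1ℤ +ℤ m) *ℤ 1ℤ ≡ (1ℤ *ℤ 1ℤ +ℤ m *ℤ 1ℤ) *ℤ 1ℤ
  cross-multiplied m = cong (λ k → (1ℤ +ℤ k) *ℤ 1ℤ) (sym (ℤ.*-identityʳ m))

Σ-const : (xs : List A) (k : ℚ) → Σ[ _ ∈ xs ] k ≡ ℕtoℚ (length xs) * k
Σ-const []       k = sym (*-zeroˡ k)
Σ-const (x ∷ xs) k = trans (cong (k +ℚ_) (Σ-const xs k)) (trans (collect k (ℕtoℚ (length xs)))
                            (cong (_* k) (sym (ℕtoℚ-suc (length xs)))))
  where
  collect : ∀ k n → k +ℚ n * k ≡ (1ℚ +ℚ n) * k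
  collect = solve-∀ ℚ-ring


≡ᵇ-refl : ∀ n → (n ≡ᵇ n) ≡ true
≡ᵇ-refl n = dec-true (n ℕ.≟ n) refl

≢⇒≡ᵇ-false : ∀ {m n} → m ≢ n → (m ≡ᵇ n) ≡ false
≢⇒≡ᵇ-false {m} {n} = dec-false (m ℕ.≟ n)

Σ-without : (xs : List ℕ) (a : ℕ) {f g : ℕ → ℚ} →
            (∀ i → i ∈ xs → i ≢ a → f i ≡ g i) → g a ≡ 0ℚ →
            Σ (filterᵇ (λ i → not (i ≡ᵇ a)) xs) f ≡ Σ xs g
Σ-without []       a f≗g ga≡0 = refl
Σ-without (i ∷ xs) a {g = g} f≗g ga≡0 with i ℕ.≟ a
... | yes refl rewrite ≡ᵇ-refl i =
  trans (Σ-without xs i (λ j j∈xs → f≗g j (there j∈xs)) ga≡0)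
        (sym (trans (cong (_+ℚ Σ xs g) ga≡0) (+-identityˡ _)))
... | no i≢a rewrite ≢⇒≡ᵇ-false i≢a =
  cong₂ _+ℚ_ (f≗g i (here refl) i≢a) (Σ-without xs a (λ j j∈xs → f≗g j (there j∈xs)) ga≡0)

∈-interval⁻ : ∀ {lo hi k} → k ∈ interval lo hi → lo ≤ k × k ≤ hi
∈-interval⁻ {lo} {hi} k∈ with ∈-map⁻ (λ i → lo + i) k∈
... | i , i∈upTo , refl = m≤m+n lo i , subst (_≤ hi) (+-comm i lo) (s≤s⁻¹ i+lo<1+hi)
  where
  i<n : i < suc hi ∸ lo
  i<n = ∈-upTo⁻ i∈upTo
  i+lo<1+hi : suc i + lo ≤ suc hi
  i+lo<1+hi = m≤o∸n⇒m+n≤o (suc i) (<⇒≤ (m∸n≢0⇒n<m (m<n⇒n≢0 i<n))) i<n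

∈-interval⁺ : ∀ {lo hi k} → lo ≤ k → k ≤ hi → k ∈ interval lo hi
∈-interval⁺ {lo} {hi} lo≤k k≤hi =
  subst (_∈ interval lo hi) (m+[n∸m]≡n lo≤k)
        (∈-map⁺ (λ i → lo + i) (∈-upTo⁺ (∸-monoˡ-< (s≤s k≤hi) lo≤k)))

interval-unique : ∀ lo hi → Unique (interval lo hi)
interval-unique lo hi = Unique.map⁺ (λ {i} {j} → +-cancelˡ-≡ lo i j) (Unique.upTo⁺ (suc hi ∸ lo))

length-interval : ∀ n → length (interval 1 n) ≡ n
length-interval n = trans (length-map (λ k → 1 + k) (upTo n)) (length-upTo n)

ι : Bool → ℚ
ι b = if b then 1ℚ else 0ℚ

δ : ℕ → ℕ → ℚ
δ m n = ι (m ≡ᵇ n)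

δ-refl : ∀ n → δ n n ≡ 1ℚ
δ-refl n = cong ι (≡ᵇ-refl n)

δ-≢ : ∀ {m n} → m ≢ n → δ m n ≡ 0ℚ
δ-≢ m≢n = cong ι (≢⇒≡ᵇ-false m≢n)

δ-sym : ∀ m n → δ m n ≡ δ n m
δ-sym m n with m ℕ.≟ n
... | yes refl = refl
... | no m≢n   = trans (δ-≢ m≢n) (sym (δ-≢ (≢-sym m≢n)))

ι-∧ : ∀ A B → ι (A ∧ B) ≡ ι A * ι B
ι-∧ true  true  = refl
ι-∧ true  false = refl
ι-∧ false true  = refl
ι-∧ false false = refl

Σ-interval-support : ∀ {lo hi a} (f : ℕ → ℚ) → lo ≤ a → a ≤ hi → (∀ k → k ≢ a → f k ≡ 0ℚ) →
                     Σ (interval lo hi) f ≡ f a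
Σ-interval-support {lo} {hi} f lo≤a a≤hi = Σ-support f (interval-unique lo hi) (∈-interval⁺ lo≤a a≤hi)

Σ-δ : ∀ {lo hi a} → lo ≤ a → a ≤ hi → Σ[ k ∈ interval lo hi ] δ a k ≡ 1ℚ
Σ-δ {a = a} lo≤a a≤hi =
  trans (Σ-interval-support (δ a) lo≤a a≤hi (λ k k≢a → δ-≢ (≢-sym k≢a))) (δ-refl a)

Σ-δ-sift : ∀ {lo hi a} (f : ℕ → ℚ) → lo ≤ a → a ≤ hi → Σ[ k ∈ interval lo hi ] (δ k a * f k) ≡ f a
Σ-δ-sift {a = a} f lo≤a a≤hi =
  trans (Σ-interval-support (λ k → δ k a * f k) lo≤a a≤hi
                            (λ k k≢a → trans (cong (_* f k) (δ-≢ k≢a)) (*-zeroˡ (f k))))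
        (trans (cong (_* f a) (δ-refl a)) (*-identityˡ (f a)))

Σ-δ-sift-outer : ∀ {lo hi a} (xs : ℕ → List B) (f : ℕ → B → ℚ) → lo ≤ a → a ≤ hi →
                 Σ[ k ∈ interval lo hi ] Σ[ j ∈ xs k ] (δ k a * f k j) ≡ Σ (xs a) (f a)
Σ-δ-sift-outer {lo = lo} {hi} {a} xs f lo≤a a≤hi =
  trans (Σ-cong (interval lo hi) (λ k _ → Σ-*ˡ (xs k) (δ k a) (f k)))
        (Σ-δ-sift (λ k → Σ (xs k) (f k)) lo≤a a≤hi)

Σ-δ-outside : ∀ {lo hi a} (f : ℕ → ℚ) → a < lo ⊎ hi < a → Σ[ k ∈ interval lo hi ] (δ k a * f k) ≡ 0ℚ
Σ-δ-outside {lo} {hi} {a} f a∉ =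
  Σ-zero _ (λ k k∈ → trans (cong (_* f k) (δ-≢ (k≢a a∉ (∈-interval⁻ k∈)))) (*-zeroˡ (f k)))
  where
  k≢a : ∀ {k} → a < lo ⊎ hi < a → lo ≤ k × k ≤ hi → k ≢ a
  k≢a (inj₁ a<lo) (lo≤k , _)   = >⇒≢ (<-≤-trans a<lo lo≤k)
  k≢a (inj₂ hi<a) (_ , k≤hi)   = <⇒≢ (≤-<-trans k≤hi hi<a)


-- The graph G_{c,b} and its coboundary δ₁

IsTriangle : ℕ → ℕ → Tri → Set
IsTriangle c b (p , q , r) = 1 ≤ p × p < q × q ≤ c × q < r × r ≤ b + c

∈-triangles⁻ : ∀ {c b T} → T ∈ triangles c b → IsTriangle c b T
∈-triangles⁻ {c} {b} T∈ with find (∈-concatMap⁻ _ {xs = interval 1 c} T∈)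
... | p , p∈ , T∈p with find (∈-concatMap⁻ _ {xs = interval (suc p) c} T∈p)
... | q , q∈ , T∈pq with ∈-map⁻ (λ r → (p , q , r)) T∈pq
... | r , r∈ , refl with ∈-interval⁻ p∈ | ∈-interval⁻ q∈ | ∈-interval⁻ r∈
... | 1≤p , _ | p<q , q≤c | q<r , r≤N = 1≤p , p<q , q≤c , q<r , r≤N

∈-triangles⁺ : ∀ {c b p q r} → IsTriangle c b (p , q , r) → (p , q , r) ∈ triangles c b
∈-triangles⁺ {c} {b} {p} {q} (1≤p , p<q , q≤c , q<r , r≤N) =
  ∈-concatMap⁺ _ (lose (∈-interval⁺ 1≤p (≤-trans (<⇒≤ p<q) q≤c))
  (∈-concatMap⁺ _ (lose (∈-interval⁺ p<q q≤c)
  (∈-map⁺ (λ r → (p , q , r)) (∈-interval⁺ q<r r≤N)))))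

Σ-triangles : ∀ c b (f : Tri → ℚ) → Σ (triangles c b) f ≡
  Σ[ p ∈ interval 1 c ] Σ[ q ∈ interval (suc p) c ] Σ[ r ∈ interval (suc q) (b + c) ] f (p , q , r)
Σ-triangles c b f =
  trans (Σ-concatMap _ (interval 1 c) f) (Σ-cong (interval 1 c) λ p _ →
  trans (Σ-concatMap _ (interval (suc p) c) f) (Σ-cong (interval (suc p) c) λ q _ →
  Σ-map (λ r → (p , q , r)) (interval (suc q) (b + c)) f))

Σ-edges : ∀ c b (f : Edge → ℚ) → Σ (edges c b) f ≡
  (Σ[ i ∈ interval 1 c ] Σ[ j ∈ interval (suc i) c ] f (i , j))
  +ℚ (Σ[ j ∈ interval 1 c ] Σ[ i ∈ interval (suc c) (b + c) ] f (j , i))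
Σ-edges c b f = trans (Σ-++ (concatMap clique (interval 1 c)) (concatMap star (interval 1 c)) f)
  (cong₂ _+ℚ_
    (trans (Σ-concatMap clique (interval 1 c) f)
           (Σ-cong (interval 1 c) (λ i _ → Σ-map (i ,_) (interval (suc i) c) f)))
    (trans (Σ-concatMap star (interval 1 c) f)
           (Σ-cong (interval 1 c) (λ j _ → Σ-map (j ,_) (interval (suc c) (b + c)) f))))
  where
  clique star : ℕ → List Edge
  clique i = map (i ,_) (interval (suc i) c)
  star j = map (j ,_) (interval (suc c) (b + c))

basis-δ : ∀ a₁ a₂ a₃ p q r → basis (a₁ , a₂ , a₃) (p , q , r) ≡ δ p a₁ * (δ q a₂ * δ r a₃)
basis-δ a₁ a₂ a₃ p q r =
  trans (ι-∧ (a₁ ≡ᵇ p) _) (cong₂ _*_ (δ-sym a₁ p)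
  (trans (ι-∧ (a₂ ≡ᵇ q) _) (cong₂ _*_ (δ-sym a₂ q) (δ-sym a₃ r))))

δ₂ : Edge → Edge → ℚ
δ₂ (j , k) (a , a') = δ j a * δ k a'

incidence-table : ∀ A B C D → (A ∧ C) ≡ false → (B ∧ D) ≡ false →
  (if A ∧ B then 1ℚ else if C ∧ D then 1ℚ else if A ∧ D then -ℚ 1ℚ else 0ℚ)
    ≡ ι A * ι B +ℚ ι C * ι D -ℚ ι A * ι D
incidence-table true  _     true  _     () _
incidence-table _     true  _     true  _  ()
incidence-table true  true  false false _  _ = refl
incidence-table true  false false true  _  _ = refl
incidence-table true  false false false _  _ = refl
incidence-table false true  true  false _  _ = refl
incidence-table false true  false false _  _ = refl
incidence-table false false true  true  _  _ = refl
incidence-table false false true  false _  _ = refl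
incidence-table false false false true  _  _ = refl
incidence-table false false false false _  _ = refl

≡ᵇ-∧-≢ : ∀ {m n} k → m ≢ n → ((k ≡ᵇ m) ∧ (k ≡ᵇ n)) ≡ false
≡ᵇ-∧-≢ {m} k m≢n with k ℕ.≟ m
... | yes refl rewrite ≡ᵇ-refl k = ≢⇒≡ᵇ-false m≢n
... | no k≢m   rewrite ≢⇒≡ᵇ-false k≢m = refl

incidence-δ₂ : ∀ {p q r} → p < q → q < r → ∀ e →
  incidence (p , q , r) e ≡ δ₂ e (p , q) +ℚ δ₂ e (q , r) -ℚ δ₂ e (p , r)
incidence-δ₂ {p} {q} {r} p<q q<r (j , k) =
  incidence-table (j ≡ᵇ p) (k ≡ᵇ q) (j ≡ᵇ q) (k ≡ᵇ r)
                  (≡ᵇ-∧-≢ j (<⇒≢ p<q)) (≡ᵇ-∧-≢ k (<⇒≢ q<r))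

δ₁ : ℕ → ℕ → (Edge → ℚ) → TVec
δ₁ c b g T = Σ[ e ∈ edges c b ] (incidence T e * g e)

δ₁ᵀ : ℕ → ℕ → TVec → Edge → ℚ
δ₁ᵀ c b v e = Σ[ T ∈ triangles c b ] (incidence T e * v T)

Σ-triangles-basis : ∀ {c b a₁ a₂ a₃} → IsTriangle c b (a₁ , a₂ , a₃) → (g : Tri → ℚ) →
                    Σ[ T ∈ triangles c b ] (g T * basis (a₁ , a₂ , a₃) T) ≡ g (a₁ , a₂ , a₃)
Σ-triangles-basis {c} {b} {a₁} {a₂} {a₃} (1≤a₁ , a₁<a₂ , a₂≤c , a₂<a₃ , a₃≤N) g = begin
  Σ[ T ∈ triangles c b ] (g T * basis (a₁ , a₂ , a₃) T)
    ≡⟨ Σ-triangles c b _ ⟩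
  Σ[ p ∈ interval 1 c ] Σ[ q ∈ interval (suc p) c ] Σ[ r ∈ interval (suc q) (b + c) ]
    (g (p , q , r) * basis (a₁ , a₂ , a₃) (p , q , r))
    ≡⟨ Σ-cong (interval 1 c) (λ p _ → Σ-cong (interval (suc p) c) (λ q _ → factor p q)) ⟩
  Σ[ p ∈ interval 1 c ] Σ[ q ∈ interval (suc p) c ] (δ p a₁ * (δ q a₂ * h p q))
    ≡⟨ Σ-δ-sift-outer (λ p → interval (suc p) c) (λ p q → δ q a₂ * h p q)
                      1≤a₁ (≤-trans (<⇒≤ a₁<a₂) a₂≤c) ⟩
  Σ[ q ∈ interval (suc a₁) c ] (δ q a₂ * h a₁ q)
    ≡⟨ Σ-δ-sift (h a₁) a₁<a₂ a₂≤c ⟩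
  h a₁ a₂
    ≡⟨ Σ-δ-sift (λ r → g (a₁ , a₂ , r)) a₂<a₃ a₃≤N ⟩
  g (a₁ , a₂ , a₃) ∎
  where
  open ≡-Reasoning
  h : ℕ → ℕ → ℚ
  h p q = Σ[ r ∈ interval (suc q) (b + c) ] (δ r a₃ * g (p , q , r))
  rearrange : ∀ x y z w → w * (x * (y * z)) ≡ x * (y * (z * w))
  rearrange = solve-∀ ℚ-ring
  factor : ∀ p q → Σ[ r ∈ interval (suc q) (b + c) ] (g (p , q , r) * basis (a₁ , a₂ , a₃) (p , q , r))
                   ≡ δ p a₁ * (δ q a₂ * h p q)
  factor p q = begin
    Σ[ r ∈ interval (suc q) (b + c) ] (g (p , q , r) * basis (a₁ , a₂ , a₃) (p , q , r))
      ≡⟨ Σ-cong (interval (suc q) (b + c)) (λ r _ →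
           trans (cong (g (p , q , r) *_) (basis-δ a₁ a₂ a₃ p q r))
                 (rearrange (δ p a₁) (δ q a₂) (δ r a₃) (g (p , q , r)))) ⟩
    Σ[ r ∈ interval (suc q) (b + c) ] (δ p a₁ * (δ q a₂ * (δ r a₃ * g (p , q , r))))
      ≡⟨ Σ-*ˡ (interval (suc q) (b + c)) (δ p a₁) _ ⟩
    δ p a₁ * (Σ[ r ∈ interval (suc q) (b + c) ] (δ q a₂ * (δ r a₃ * g (p , q , r))))
      ≡⟨ cong (δ p a₁ *_) (Σ-*ˡ (interval (suc q) (b + c)) (δ q a₂) _) ⟩
    δ p a₁ * (δ q a₂ * h p q) ∎

Σ-edges-δ₂ : ∀ {c b j k} → 1 ≤ j → j ≤ c → j < k → k ≤ b + c → (g : Edge → ℚ) →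
             Σ[ e ∈ edges c b ] (δ₂ e (j , k) * g e) ≡ g (j , k)
Σ-edges-δ₂ {c} {b} {j} {k} 1≤j j≤c j<k k≤N g =
  trans (Σ-edges c b _)
        (trans (cong₂ _+ℚ_ (sift-first (λ i → interval (suc i) c))
                           (sift-first (λ _ → interval (suc c) (b + c))))
               (sift-second (k ℕ.≤? c)))
  where
  sift-first : (xs : ℕ → List ℕ) →
    Σ[ i ∈ interval 1 c ] Σ[ i' ∈ xs i ] (δ₂ (i , i') (j , k) * g (i , i'))
      ≡ Σ[ i' ∈ xs j ] (δ i' k * g (j , i'))
  sift-first xs =
    trans (Σ-cong (interval 1 c) (λ i _ → Σ-cong (xs i) (λ i' _ → *-assoc (δ i j) (δ i' k) (g (i , i')))))
          (Σ-δ-sift-outer xs (λ i i' → δ i' k * g (i , i')) 1≤j j≤c)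
  sift-second : Dec (k ≤ c) →
    (Σ[ i' ∈ interval (suc j) c ] (δ i' k * g (j , i')))
      +ℚ (Σ[ i' ∈ interval (suc c) (b + c) ] (δ i' k * g (j , i'))) ≡ g (j , k)
  sift-second (yes k≤c) =
    trans (cong₂ _+ℚ_ (Σ-δ-sift (λ i' → g (j , i')) j<k k≤c)
                      (Σ-δ-outside {hi = b + c} (λ i' → g (j , i')) (inj₁ (s≤s k≤c))))
          (+-identityʳ (g (j , k)))
  sift-second (no k≰c) =
    trans (cong₂ _+ℚ_ (Σ-δ-outside {lo = suc j} (λ i' → g (j , i')) (inj₂ (≰⇒> k≰c)))
                      (Σ-δ-sift (λ i' → g (j , i')) (≰⇒> k≰c) k≤N))
          (+-identityˡ (g (j , k)))

δ₁-apply : ∀ {c b p q r} → IsTriangle c b (p , q , r) → (g : Edge → ℚ) →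
           δ₁ c b g (p , q , r) ≡ g (p , q) +ℚ g (q , r) -ℚ g (p , r)
δ₁-apply {c} {b} {p} {q} {r} (1≤p , p<q , q≤c , q<r , r≤N) g = begin
  Σ[ e ∈ edges c b ] (incidence (p , q , r) e * g e)
    ≡⟨ Σ-cong (edges c b) (λ e _ → trans (cong (_* g e) (incidence-δ₂ p<q q<r e))
                                         (distrib (δ₂ e (p , q)) (δ₂ e (q , r)) (δ₂ e (p , r)) (g e))) ⟩
  Σ[ e ∈ edges c b ] (δ₂ e (p , q) * g e +ℚ δ₂ e (q , r) * g e -ℚ δ₂ e (p , r) * g e)
    ≡⟨ Σ-− (edges c b) _ _ ⟩
  (Σ[ e ∈ edges c b ] (δ₂ e (p , q) * g e +ℚ δ₂ e (q , r) * g e))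
    -ℚ (Σ[ e ∈ edges c b ] (δ₂ e (p , r) * g e))
    ≡⟨ cong (_-ℚ (Σ[ e ∈ edges c b ] (δ₂ e (p , r) * g e))) (Σ-+ (edges c b) _ _) ⟩
  (Σ[ e ∈ edges c b ] (δ₂ e (p , q) * g e)) +ℚ (Σ[ e ∈ edges c b ] (δ₂ e (q , r) * g e))
    -ℚ (Σ[ e ∈ edges c b ] (δ₂ e (p , r) * g e))
    ≡⟨ cong₂ _-ℚ_ (cong₂ _+ℚ_ (Σ-edges-δ₂ 1≤p p≤c p<q (≤-trans (<⇒≤ q<r) r≤N) g)
                              (Σ-edges-δ₂ (≤-trans 1≤p (<⇒≤ p<q)) q≤c q<r r≤N g))
                  (Σ-edges-δ₂ 1≤p p≤c (<-trans p<q q<r) r≤N g) ⟩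
  g (p , q) +ℚ g (q , r) -ℚ g (p , r) ∎
  where
  open ≡-Reasoning
  p≤c = ≤-trans (<⇒≤ p<q) q≤c
  distrib : ∀ x y z w → (x +ℚ y -ℚ z) * w ≡ x * w +ℚ y * w -ℚ z * w
  distrib = solve-∀ ℚ-ring

δ₁ᵀ-cong : ∀ c b {u w : TVec} → (∀ T → u T ≡ w T) → ∀ e → δ₁ᵀ c b u e ≡ δ₁ᵀ c b w e
δ₁ᵀ-cong c b u≗w e = Σ-cong (triangles c b) (λ T _ → cong (incidence T e *_) (u≗w T))

δ₁ᵀ-Σ : ∀ c b (xs : List A) (f : A → TVec) e →
        δ₁ᵀ c b (λ T → Σ[ i ∈ xs ] f i T) e ≡ Σ[ i ∈ xs ] δ₁ᵀ c b (f i) e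
δ₁ᵀ-Σ c b xs f e =
  trans (Σ-cong (triangles c b) (λ T _ → sym (Σ-*ˡ xs (incidence T e) (λ i → f i T))))
        (Σ-swap (triangles c b) xs (λ T i → incidence T e * f i T))

δ₁ᵀ-basis-difference : ∀ {c b a a' z z'} →
  IsTriangle c b (a , a' , z) → IsTriangle c b (a , a' , z') → ∀ j k →
  δ₁ᵀ c b (λ T → basis (a , a' , z) T -ℚ basis (a , a' , z') T) (j , k)
    ≡ (δ k z -ℚ δ k z') * (δ j a' -ℚ δ j a)
δ₁ᵀ-basis-difference {c} {b} {a} {a'} {z} {z'} t@(_ , a<a' , _ , a'<z , _) t'@(_ , _ , _ , a'<z' , _) j k = begin
  Σ[ T ∈ triangles c b ] (incidence T (j , k) * (basis (a , a' , z) T -ℚ basis (a , a' , z') T))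
    ≡⟨ Σ-cong (triangles c b) (λ T _ →
         distrib (incidence T (j , k)) (basis (a , a' , z) T) (basis (a , a' , z') T)) ⟩
  Σ[ T ∈ triangles c b ]
    (incidence T (j , k) * basis (a , a' , z) T -ℚ incidence T (j , k) * basis (a , a' , z') T)
    ≡⟨ Σ-− (triangles c b) _ _ ⟩
  (Σ[ T ∈ triangles c b ] (incidence T (j , k) * basis (a , a' , z) T))
    -ℚ (Σ[ T ∈ triangles c b ] (incidence T (j , k) * basis (a , a' , z') T))
    ≡⟨ cong₂ _-ℚ_ (Σ-triangles-basis t (λ T → incidence T (j , k)))
                  (Σ-triangles-basis t' (λ T → incidence T (j , k))) ⟩
  incidence (a , a' , z) (j , k) -ℚ incidence (a , a' , z') (j , k)
    ≡⟨ cong₂ _-ℚ_ (incidence-δ₂ a<a' a'<z (j , k)) (incidence-δ₂ a<a' a'<z' (j , k)) ⟩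
  δ j a * δ k a' +ℚ δ j a' * δ k z -ℚ δ j a * δ k z
    -ℚ (δ j a * δ k a' +ℚ δ j a' * δ k z' -ℚ δ j a * δ k z')
    ≡⟨ boundary-difference (δ j a * δ k a') (δ j a') (δ j a) (δ k z) (δ k z') ⟩
  (δ k z -ℚ δ k z') * (δ j a' -ℚ δ j a) ∎
  where
  open ≡-Reasoning
  distrib : ∀ g u w → g * (u -ℚ w) ≡ g * u -ℚ g * w
  distrib = solve-∀ ℚ-ring
  boundary-difference : ∀ e B C Z Z' →
    e +ℚ B * Z -ℚ C * Z -ℚ (e +ℚ B * Z' -ℚ C * Z') ≡ (Z -ℚ Z') * (B -ℚ C)
  boundary-difference = solve-∀ ℚ-ring


≤ᵇ-true : ∀ {m n} → m ≤ n → (m ≤ᵇ n) ≡ true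
≤ᵇ-true {m} {n} = dec-true (m ℕ.≤? n)

≤ᵇ-false : ∀ {m n} → n < m → (m ≤ᵇ n) ≡ false
≤ᵇ-false {m} {n} n<m = dec-false (m ℕ.≤? n) (<⇒≱ n<m)

sort2-< : ∀ {x z} → x < z → sort2 x z ≡ (x , z)
sort2-< x<z rewrite ≤ᵇ-true (<⇒≤ x<z) = refl

sort3-< : ∀ {i x z} → i < x → x < z → sort3 i x z ≡ (i , x , z)
sort3-< i<x x<z rewrite ≤ᵇ-true (<⇒≤ i<x) | ≤ᵇ-false (<-trans i<x x<z) | ≤ᵇ-false x<z = refl

sort3-> : ∀ {i x z} → x < i → i < z → sort3 i x z ≡ (x , i , z)
sort3-> x<i i<z rewrite ≤ᵇ-false x<i | ≤ᵇ-false (<-trans x<i i<z) | ≤ᵇ-false i<z = refl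

incidence-qr : ∀ {p q r} → p < q → q < r → incidence (p , q , r) (q , r) ≡ 1ℚ
incidence-qr {p} {q} {r} p<q q<r rewrite ≢⇒≡ᵇ-false (>⇒≢ p<q) | ≡ᵇ-refl q | ≡ᵇ-refl r = refl

incidence-pr : ∀ {p q r} → p < q → q < r → incidence (p , q , r) (p , r) ≡ -ℚ 1ℚ
incidence-pr {p} {q} {r} p<q q<r
  rewrite ≡ᵇ-refl p | ≢⇒≡ᵇ-false (>⇒≢ q<r) | ≢⇒≡ᵇ-false (<⇒≢ p<q) | ≡ᵇ-refl r = refl

-- The summand [{i,x,z}:{x,z}] e_{{i,x,z}} of v_{x,y}, for z = y or b + c: the sorted triangle
-- with the sign of the permutation sorting (i, x, z), i.e. the oriented triangle (i, x, z).
oriented : ℕ → ℕ → ℕ → TVec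
oriented i x z T = incidence (sort3 i x z) (sort2 x z) * basis (sort3 i x z) T

oriented-< : ∀ {i x z} → i < x → x < z → ∀ T → oriented i x z T ≡ basis (i , x , z) T
oriented-< i<x x<z T rewrite sort3-< i<x x<z | sort2-< x<z | incidence-qr i<x x<z = *-identityˡ _

oriented-> : ∀ {i x z} → x < i → i < z → ∀ T → oriented i x z T ≡ -ℚ basis (x , i , z) T
oriented-> x<i i<z T rewrite sort3-> x<i i<z | sort2-< (<-trans x<i i<z) | incidence-pr x<i i<z = neg-one _
  where
  neg-one : ∀ u → -ℚ 1ℚ * u ≡ -ℚ u
  neg-one = solve-∀ ℚ-ring

δ*δ-reversed : ∀ {p q a a'} → p < q → a' < a → δ p a * δ q a' ≡ 0ℚ
δ*δ-reversed {p} {q} {a} {a'} p<q a'<a with p ℕ.≟ a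
... | yes refl = trans (cong (δ p p *_) (δ-≢ (>⇒≢ (<-trans a'<a p<q)))) (*-zeroʳ (δ p p))
... | no p≢a   = trans (cong (_* δ q a') (δ-≢ p≢a)) (*-zeroˡ (δ q a'))

oriented-apply : ∀ {i x z} p q r → i ≢ x → i < z → x < z → p < q →
                 oriented i x z (p , q , r) ≡ δ r z * (δ q x * δ p i -ℚ δ p x * δ q i)
oriented-apply {i} {x} {z} p q r i≢x i<z x<z p<q with <-cmp i x
... | tri< i<x _ _ =
  trans (oriented-< i<x x<z (p , q , r)) (trans (basis-δ i x z p q r)
  (trans (reorder (δ p i) (δ q x) (δ r z))
         (cong (λ t → δ r z * (δ q x * δ p i -ℚ t)) (sym (δ*δ-reversed p<q i<x)))))
  where
  reorder : ∀ u v w → u * (v * w) ≡ w * (v * u -ℚ 0ℚ)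
  reorder = solve-∀ ℚ-ring
... | tri≈ _ i≡x _ = contradiction i≡x i≢x
... | tri> _ _ x<i =
  trans (oriented-> x<i i<z (p , q , r)) (trans (cong -ℚ_ (basis-δ x i z p q r))
  (trans (reorder (δ p x) (δ q i) (δ r z))
         (cong (λ t → δ r z * (t -ℚ δ p x * δ q i))
               (sym (trans (*-comm (δ q x) (δ p i)) (δ*δ-reversed p<q x<i))))))
  where
  reorder : ∀ u v w → -ℚ (u * (v * w)) ≡ w * (0ℚ -ℚ u * v)
  reorder = solve-∀ ℚ-ring


-- The vectors v_{x,y}

module _ (c b x y : ℕ) (1≤x : 1 ≤ x) (x≤c : x ≤ c) (c<y : c < y) (y<N : y < b + c) where

  private
    x<y : x < y
    x<y = ≤-<-trans x≤c c<y
    c<N : c < b + c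
    c<N = <-trans c<y y<N

  ε : ℕ → ℚ
  ε r = δ r y -ℚ δ r (b + c)

  ε-vanishes : ∀ {r} → r ≤ c → ε r ≡ 0ℚ
  ε-vanishes r≤c = cong₂ _-ℚ_ (δ-≢ (<⇒≢ (≤-<-trans r≤c c<y))) (δ-≢ (<⇒≢ (≤-<-trans r≤c c<N)))

  summand : ℕ → TVec
  summand i T = oriented i x y T -ℚ oriented i x (b + c) T

  summand-apply : ∀ {i} p q r → i ≢ x → i ≤ c → p < q →
                  summand i (p , q , r) ≡ ε r * (δ q x * δ p i -ℚ δ p x * δ q i)
  summand-apply {i} p q r i≢x i≤c p<q =
    trans (cong₂ _-ℚ_ (oriented-apply p q r i≢x (≤-<-trans i≤c c<y) x<y p<q)
                      (oriented-apply p q r i≢x (≤-<-trans i≤c c<N) (≤-<-trans x≤c c<N) p<q))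
          (factor (δ r y) (δ r (b + c)) _)
    where
    factor : ∀ u w t → u * t -ℚ w * t ≡ (u -ℚ w) * t
    factor = solve-∀ ℚ-ring

  vxy-apply : ∀ {p q} r → 1 ≤ p → p < q → q ≤ c → vxy c b x y (p , q , r) ≡ ε r * (δ q x -ℚ δ p x)
  vxy-apply {p} {q} r 1≤p p<q q≤c = begin
    vxy c b x y (p , q , r)
      ≡⟨⟩
    Σ[ i ∈ filterᵇ (λ i → not (i ≡ᵇ x)) (interval 1 c) ] summand i (p , q , r)
      ≡⟨ Σ-without (interval 1 c) x
           (λ i i∈ i≢x → summand-apply p q r i≢x (proj₂ (∈-interval⁻ i∈)) p<q)
           (at-x (ε r) (δ p x) (δ q x)) ⟩
    Σ[ i ∈ interval 1 c ] (ε r * (δ q x * δ p i -ℚ δ p x * δ q i))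
      ≡⟨ Σ-*ˡ (interval 1 c) (ε r) _ ⟩
    ε r * (Σ[ i ∈ interval 1 c ] (δ q x * δ p i -ℚ δ p x * δ q i))
      ≡⟨ cong (ε r *_) (Σ-− (interval 1 c) _ _) ⟩
    ε r * ((Σ[ i ∈ interval 1 c ] (δ q x * δ p i)) -ℚ (Σ[ i ∈ interval 1 c ] (δ p x * δ q i)))
      ≡⟨ cong (ε r *_) (cong₂ _-ℚ_ (Σ-*ˡ (interval 1 c) (δ q x) (δ p))
                                    (Σ-*ˡ (interval 1 c) (δ p x) (δ q))) ⟩
    ε r * (δ q x * (Σ[ i ∈ interval 1 c ] δ p i) -ℚ δ p x * (Σ[ i ∈ interval 1 c ] δ q i))
      ≡⟨ cong (ε r *_) (cong₂ (λ s t → δ q x * s -ℚ δ p x * t)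
                              (Σ-δ 1≤p p≤c) (Σ-δ (≤-trans 1≤p (<⇒≤ p<q)) q≤c)) ⟩
    ε r * (δ q x * 1ℚ -ℚ δ p x * 1ℚ)
      ≡⟨ drop-ones (ε r) (δ q x) (δ p x) ⟩
    ε r * (δ q x -ℚ δ p x) ∎
    where
    open ≡-Reasoning
    p≤c = ≤-trans (<⇒≤ p<q) q≤c
    at-x : ∀ e u v → e * (v * u -ℚ u * v) ≡ 0ℚ
    at-x = solve-∀ ℚ-ring
    drop-ones : ∀ e u v → e * (u * 1ℚ -ℚ v * 1ℚ) ≡ e * (u -ℚ v)
    drop-ones = solve-∀ ℚ-ring

  δ₁ᵀ-summand : ∀ {i} j k → i ≢ x → 1 ≤ i → i ≤ c →
                δ₁ᵀ c b (summand i) (j , k) ≡ ε k * (δ j x -ℚ δ j i)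
  δ₁ᵀ-summand {i} j k i≢x 1≤i i≤c with <-cmp i x
  ... | tri< i<x _ _ =
    trans (δ₁ᵀ-cong c b (λ T → cong₂ _-ℚ_ (oriented-< i<x x<y T) (oriented-< i<x (≤-<-trans x≤c c<N) T))
                    (j , k))
          (δ₁ᵀ-basis-difference (1≤i , i<x , x≤c , x<y , <⇒≤ y<N)
                                (1≤i , i<x , x≤c , ≤-<-trans x≤c c<N , ≤-refl) j k)
  ... | tri≈ _ i≡x _ = contradiction i≡x i≢x
  ... | tri> _ _ x<i =
    trans (δ₁ᵀ-cong c b (λ T → trans (cong₂ _-ℚ_ (oriented-> x<i (≤-<-trans i≤c c<y) T)
                                                 (oriented-> x<i (≤-<-trans i≤c c<N) T))
                                     (swap (basis (x , i , y) T) (basis (x , i , b + c) T))) (j , k))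
          (trans (δ₁ᵀ-basis-difference (1≤x , x<i , i≤c , ≤-<-trans i≤c c<N , ≤-refl)
                                       (1≤x , x<i , i≤c , ≤-<-trans i≤c c<y , <⇒≤ y<N) j k)
                 (flip (δ k (b + c)) (δ k y) (δ j i) (δ j x)))
    where
    swap : ∀ u w → -ℚ u -ℚ -ℚ w ≡ w -ℚ u
    swap = solve-∀ ℚ-ring
    flip : ∀ n m u v → (n -ℚ m) * (u -ℚ v) ≡ (m -ℚ n) * (v -ℚ u)
    flip = solve-∀ ℚ-ring

  δ₁ᵀ-vxy : ∀ {j} k → 1 ≤ j → j ≤ c →
            δ₁ᵀ c b (vxy c b x y) (j , k) ≡ ε k * (ℕtoℚ c * δ j x -ℚ 1ℚ)
  δ₁ᵀ-vxy {j} k 1≤j j≤c = begin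
    δ₁ᵀ c b (vxy c b x y) (j , k)
      ≡⟨ δ₁ᵀ-Σ c b (filterᵇ (λ i → not (i ≡ᵇ x)) (interval 1 c)) summand (j , k) ⟩
    Σ[ i ∈ filterᵇ (λ i → not (i ≡ᵇ x)) (interval 1 c) ] δ₁ᵀ c b (summand i) (j , k)
      ≡⟨ Σ-without (interval 1 c) x
           (λ i i∈ i≢x → let (1≤i , i≤c) = ∈-interval⁻ i∈ in δ₁ᵀ-summand j k i≢x 1≤i i≤c)
           (at-x (ε k) (δ j x)) ⟩
    Σ[ i ∈ interval 1 c ] (ε k * (δ j x -ℚ δ j i))
      ≡⟨ Σ-*ˡ (interval 1 c) (ε k) _ ⟩
    ε k * (Σ[ i ∈ interval 1 c ] (δ j x -ℚ δ j i))
      ≡⟨ cong (ε k *_) (Σ-− (interval 1 c) _ _) ⟩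
    ε k * ((Σ[ i ∈ interval 1 c ] δ j x) -ℚ (Σ[ i ∈ interval 1 c ] δ j i))
      ≡⟨ cong (ε k *_) (cong₂ _-ℚ_ (trans (Σ-const (interval 1 c) (δ j x))
                                           (cong (λ n → ℕtoℚ n * δ j x) (length-interval c)))
                                    (Σ-δ 1≤j j≤c)) ⟩
    ε k * (ℕtoℚ c * δ j x -ℚ 1ℚ) ∎
    where
    open ≡-Reasoning
    at-x : ∀ e u → e * (u -ℚ u) ≡ 0ℚ
    at-x = solve-∀ ℚ-ring

  downLaplacian-vxy : ∀ {T} → T ∈ triangles c b →
                      downLaplacian c b (vxy c b x y) T ≡ ℕtoℚ c * vxy c b x y T
  downLaplacian-vxy {p , q , r} T∈ with ∈-triangles⁻ T∈
  ... | t@(1≤p , p<q , q≤c , q<r , r≤N) = begin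
    downLaplacian c b (vxy c b x y) (p , q , r)
      ≡⟨⟩
    δ₁ c b (δ₁ᵀ c b (vxy c b x y)) (p , q , r)
      ≡⟨ δ₁-apply t (δ₁ᵀ c b (vxy c b x y)) ⟩
    δ₁ᵀ c b (vxy c b x y) (p , q) +ℚ δ₁ᵀ c b (vxy c b x y) (q , r) -ℚ δ₁ᵀ c b (vxy c b x y) (p , r)
      ≡⟨ cong₂ _-ℚ_ (cong₂ _+ℚ_ (δ₁ᵀ-vxy q 1≤p p≤c) (δ₁ᵀ-vxy r 1≤q q≤c)) (δ₁ᵀ-vxy r 1≤p p≤c) ⟩
    ε q * (C * δ p x -ℚ 1ℚ) +ℚ ε r * (C * δ q x -ℚ 1ℚ) -ℚ ε r * (C * δ p x -ℚ 1ℚ)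
      ≡⟨ cong (λ e → e * (C * δ p x -ℚ 1ℚ) +ℚ ε r * (C * δ q x -ℚ 1ℚ) -ℚ ε r * (C * δ p x -ℚ 1ℚ))
              (ε-vanishes q≤c) ⟩
    0ℚ * (C * δ p x -ℚ 1ℚ) +ℚ ε r * (C * δ q x -ℚ 1ℚ) -ℚ ε r * (C * δ p x -ℚ 1ℚ)
      ≡⟨ collect C (ε r) (δ p x) (δ q x) ⟩
    C * (ε r * (δ q x -ℚ δ p x))
      ≡⟨ cong (C *_) (sym (vxy-apply r 1≤p p<q q≤c)) ⟩
    C * vxy c b x y (p , q , r) ∎
    where
    open ≡-Reasoning
    C = ℕtoℚ c
    p≤c = ≤-trans (<⇒≤ p<q) q≤c
    1≤q = ≤-trans 1≤p (<⇒≤ p<q)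
    collect : ∀ C e u v →
      0ℚ * (C * u -ℚ 1ℚ) +ℚ e * (C * v -ℚ 1ℚ) -ℚ e * (C * u -ℚ 1ℚ) ≡ C * (e * (v -ℚ u))
    collect = solve-∀ ℚ-ring

  vxy-at-1 : 2 ≤ x → ∀ {s t} → 1 < s → s ≤ c → t < b + c → vxy c b x y (1 , s , t) ≡ δ s x * δ t y
  vxy-at-1 2≤x {s} {t} 1<s s≤c t<N =
    trans (vxy-apply t ≤-refl 1<s s≤c)
          (trans (cong₂ (λ u w → (δ t y -ℚ u) * (δ s x -ℚ w)) (δ-≢ (<⇒≢ t<N)) (δ-≢ (<⇒≢ 2≤x)))
                 (drop-zeros (δ t y) (δ s x)))
    where
    drop-zeros : ∀ u w → (u -ℚ 0ℚ) * (w -ℚ 0ℚ) ≡ w * u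
    drop-zeros = solve-∀ ℚ-ring

between⇒< : ∀ {c y n} → c + 1 ≤ y → y ≤ n ∸ 1 → c < y × y < n
between⇒< {c} {y} {n} c+1≤y y≤n∸1 = c<y , y<n n y≤n∸1
  where
  c<y : c < y
  c<y = subst (_≤ y) (+-comm c 1) c+1≤y
  y<n : ∀ n → y ≤ n ∸ 1 → y < n
  y<n zero    y≤0 = contradiction (<-≤-trans c<y y≤0) λ ()
  y<n (suc n) y≤n = s≤s y≤n

combination-at-1xy : ∀ c b (a : ℕ → ℕ → ℚ) {x y} → 2 ≤ x → x ≤ c → c + 1 ≤ y → y ≤ b + c ∸ 1 →
  Σ[ x' ∈ interval 2 c ] Σ[ y' ∈ interval (c + 1) (b + c ∸ 1) ] (a x' y' * vxy c b x' y' (1 , x , y)) ≡ a x y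
combination-at-1xy c b a {x} {y} 2≤x x≤c c+1≤y y≤N∸1 = begin
  Σ[ x' ∈ interval 2 c ] Σ[ y' ∈ interval (c + 1) (b + c ∸ 1) ] (a x' y' * vxy c b x' y' (1 , x , y))
    ≡⟨ Σ-cong (interval 2 c) (λ x' x'∈ → Σ-cong (interval (c + 1) (b + c ∸ 1)) (λ y' y'∈ →
         cong (a x' y' *_) (vxy-at-x' x'∈ y'∈))) ⟩
  Σ[ x' ∈ interval 2 c ] Σ[ y' ∈ interval (c + 1) (b + c ∸ 1) ] (a x' y' * (δ x x' * δ y y'))
    ≡⟨ Σ-cong (interval 2 c) (λ x' _ → Σ-cong (interval (c + 1) (b + c ∸ 1)) (λ y' _ →
         trans (cong₂ (λ u w → a x' y' * (u * w)) (δ-sym x x') (δ-sym y y'))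
               (reorder (a x' y') (δ x' x) (δ y' y)))) ⟩
  Σ[ x' ∈ interval 2 c ] Σ[ y' ∈ interval (c + 1) (b + c ∸ 1) ] (δ x' x * (δ y' y * a x' y'))
    ≡⟨ Σ-δ-sift-outer (λ _ → interval (c + 1) (b + c ∸ 1)) (λ x' y' → δ y' y * a x' y') 2≤x x≤c ⟩
  Σ[ y' ∈ interval (c + 1) (b + c ∸ 1) ] (δ y' y * a x y')
    ≡⟨ Σ-δ-sift (a x) c+1≤y y≤N∸1 ⟩
  a x y ∎
  where
  open ≡-Reasoning
  reorder : ∀ u v w → u * (v * w) ≡ v * (w * u)
  reorder = solve-∀ ℚ-ring
  vxy-at-x' : ∀ {x' y'} → x' ∈ interval 2 c → y' ∈ interval (c + 1) (b + c ∸ 1) →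
              vxy c b x' y' (1 , x , y) ≡ δ x x' * δ y y'
  vxy-at-x' x'∈ y'∈ =
    let (2≤x' , x'≤c) = ∈-interval⁻ x'∈
        (c+1≤y' , y'≤N∸1) = ∈-interval⁻ y'∈
        (c<y' , y'<N) = between⇒< c+1≤y' y'≤N∸1
        (_ , y<N) = between⇒< c+1≤y y≤N∸1
    in vxy-at-1 c b _ _ (<⇒≤ 2≤x') x'≤c c<y' y'<N 2≤x' 2≤x x≤c y<N

proposition3p21 : (c b : ℕ) → 3 ≤ c → 2 ≤ b →
    ((x y : ℕ) → 2 ≤ x → x ≤ c → c + 1 ≤ y → y ≤ b + c ∸ 1 →
      (T : Tri) → T ∈ triangles c b →
      downLaplacian c b (vxy c b x y) T ≡ ℕtoℚ c * vxy c b x y T)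
    ×
    ((a : ℕ → ℕ → ℚ) →
      ((T : Tri) → T ∈ triangles c b →
        sumℚ (map (λ x → sumℚ (map (λ y → a x y * vxy c b x y T) (interval (c + 1) (b + c ∸ 1))))
                  (interval 2 c))
        ≡ 0ℚ) →
      (x y : ℕ) → 2 ≤ x → x ≤ c → c + 1 ≤ y → y ≤ b + c ∸ 1 → a x y ≡ 0ℚ)
proposition3p21 c b _ _ =
  (λ x y 2≤x x≤c c+1≤y y≤N∸1 _ T∈ →
    let (c<y , y<N) = between⇒< c+1≤y y≤N∸1 in
    downLaplacian-vxy c b x y (<⇒≤ 2≤x) x≤c c<y y<N T∈) ,
  (λ a combination≡0 x y 2≤x x≤c c+1≤y y≤N∸1 →
    let (c<y , y<N) = between⇒< c+1≤y y≤N∸1 in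
    trans (sym (combination-at-1xy c b a 2≤x x≤c c+1≤y y≤N∸1))
          (combination≡0 (1 , x , y) (∈-triangles⁺ (≤-refl , 2≤x , x≤c , ≤-<-trans x≤c c<y , <⇒≤ y<N))))
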